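{- Define, for any finite word $p$ of distinct integers, a set $\mathcal{U}(p)$ of words recursively: $\mathcal{U}(\varepsilon)=\{\varepsilon\}$ for the empty word, and if $p$ is nonempty with largest letter $m$, write $p=\alpha m\beta$ with $\alpha=a_1a_2\cdots a_i$; then $$\mathcal{U}(p)=\bigcup_{j=0}^{i}\{\gamma\, m\,\delta : \gamma\in\mathcal{U}(a_1\cdots a_j),\ \delta\in\mathcal{U}(a_{j+1}\cdots a_i\beta)\}.$$ Then $\mathcal{U}(p)$ contains all classical patterns that can become $p$ after one pass of stack-sort: that is, if $\pi$ is a permutation and $A$ is a set of entries of $\pi$ such that the entries of $A$, read in the order in which they appear in $S(\pi)$, form the word $p$, then the entries of $A$, read in the order in which they appear in $\pi$, form a word belonging to $\mathcal{U}(p)$.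
   Context: Permutations are written in one-line notation. The stack-sort operator $S$ is defined by $S(\varepsilon)=\varepsilon$ and, if $\pi=\alpha\, m\,\beta$ with $m$ the largest entry, $S(\pi)=S(\alpha)S(\beta)m$ (equivalently: read $\pi$ left to right, before pushing an entry onto a stack pop to the output all stack entries smaller than it, and pop everything at the end). -}

module Defs where

open import Data.Bool using (Bool; T)
open import Data.Nat using (ℕ; suc; _<_; _<?_)
open import Data.List using (List; []; _∷_; _++_; span; filter; map; upTo)
open import Data.List.Relation.Unary.All using (All)
open import Data.Product using (_,_)
open import Relation.Nullary.Decidable using (T?)

-- Stack-sort S, via the stack algorithm: the stack is a list whose head is
-- the top.  Before pushing x, pop (to the output) all stack entries smaller
-- than x; at the end pop everything.
stackGo : List ℕ → List ℕ → List ℕ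
stackGo stack []       = stack
stackGo stack (x ∷ xs) with span (_<? x) stack
... | small , rest = small ++ stackGo (x ∷ rest) xs

S : List ℕ → List ℕ
S π = stackGo [] π

IsPerm : ℕ → List ℕ → Set
IsPerm n π = π ↭ map suc (upTo n)
  where open import Data.List.Relation.Binary.Permutation.Propositional using (_↭_)

restrict : (ℕ → Bool) → List ℕ → List ℕ
restrict A w = filter (λ x → T? (A x)) w

-- U(p), as an inductive membership relation  InU p w  meaning  w ∈ U(p).
data InU : List ℕ → List ℕ → Set where
  U-nil  : InU [] []
  U-cons : ∀ α₁ α₂ m β γ δ →
           All (_< m) (α₁ ++ α₂) → All (_< m) β →
           InU α₁ γ → InU (α₂ ++ β) δ →
           InU (α₁ ++ α₂ ++ m ∷ β) (γ ++ m ∷ δ)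

-- If m is the largest entry of π = α m β, then S π = S α · S β · m.  Restricting to A,
-- the word A|π = (A|α) m (A|β) arises from A|S π = (A|S α)(A|S β) m by the defining rule
-- of U, splitting just after A|S α; by induction A|α ∈ U(A|S α) and A|β ∈ U(A|S β).
-- When m ∉ A one needs instead that U(p) · U(q) ⊆ U(p q) for letter-disjoint p and q:
-- if max p > max q, q is appended to the β-part of the decomposition of p; otherwise p is
-- prepended to the α₁-part of the decomposition of q.
module Submission where

open import Defs
open import Data.Bool using (Bool; true; false)
open import Data.Nat using (ℕ; suc; _<_; _≤_; _<?_; _≤?_; z<s)
open import Data.Nat.Properties
  using (<-trans; ≤-trans; <-≤-trans; ≤-pred; ≤-refl; <⇒≤; <⇒≯; ≰⇒>; <-cmp;
         m≤n⇒m<n∨m≡n; m<m+n; m≤n+m; suc-injective)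
open import Data.List using (List; []; _∷_; [_]; _++_; length; takeWhile; dropWhile)
open import Data.List.Properties using (++-assoc; ++-identityʳ; filter-++; length-++; span-defn)
open import Data.List.Relation.Unary.All as All using (All; []; _∷_)
import Data.List.Relation.Unary.All.Properties as All
open import Data.List.Relation.Unary.Any using (here; there)
open import Data.List.Membership.Propositional using (_∈_; _∉_)
open import Data.List.Membership.Propositional.Properties using (∈-++⁺ʳ)
open import Data.List.Relation.Binary.Subset.Propositional using (_⊆_)
open import Data.List.Relation.Binary.Subset.Propositional.Properties
  using (xs⊆x∷xs; xs⊆xs++ys; xs⊆ys++xs; ++⁺ʳ; filter-⊆)
open import Data.List.Relation.Binary.Disjoint.Propositional using (Disjoint)
open import Data.List.Relation.Unary.Unique.Propositional using (Unique; []; _∷_)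
import Data.List.Relation.Unary.Unique.Propositional.Properties as Unique
import Data.List.Relation.Binary.Permutation.Propositional as Perm
open import Data.List.Relation.Binary.Permutation.Setoid.Properties using (Unique-resp-↭)
open import Data.Product using (_×_; _,_; proj₁; proj₂)
open import Data.Sum using (inj₁; inj₂)
open import Data.Empty using (⊥-elim)
open import Function using (id; _∘_)
open import Relation.Nullary using (¬_; yes; no)
open import Relation.Nullary.Decidable using (T?)
open import Relation.Unary using (Pred; Decidable)
open import Relation.Binary using (tri<; tri≈; tri>)
open import Relation.Binary.PropositionalEquality
  using (_≡_; refl; sym; trans; cong; cong₂; subst; subst₂; setoid; module ≡-Reasoning)

module _ {a p} {A : Set a} {P : Pred A p} (P? : Decidable P) {y : A} (¬Py : ¬ P y) where

  takeWhile-++-stop : ∀ xs ys → takeWhile P? (xs ++ y ∷ ys) ≡ takeWhile P? xs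
  takeWhile-++-stop []       ys with P? y
  ... | yes Py = ⊥-elim (¬Py Py)
  ... | no _   = refl
  takeWhile-++-stop (x ∷ xs) ys with P? x
  ... | yes _ = cong (x ∷_) (takeWhile-++-stop xs ys)
  ... | no _  = refl

  dropWhile-++-stop : ∀ xs ys → dropWhile P? (xs ++ y ∷ ys) ≡ dropWhile P? xs ++ y ∷ ys
  dropWhile-++-stop []       ys with P? y
  ... | yes Py = ⊥-elim (¬Py Py)
  ... | no _   = refl
  dropWhile-++-stop (x ∷ xs) ys with P? x
  ... | yes _ = dropWhile-++-stop xs ys
  ... | no _  = refl

Unique-++⁻ : ∀ {a} {A : Set a} (xs : List A) {ys} → Unique (xs ++ ys) →
             Unique xs × Unique ys × Disjoint xs ys
Unique-++⁻ []       u       = [] , u , λ ()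
Unique-++⁻ (x ∷ xs) (h ∷ u) with Unique-++⁻ xs u
... | uxs , uys , xs#ys = All.++⁻ˡ xs h ∷ uxs , uys , x∷xs#ys
  where
  x∷xs#ys : Disjoint (x ∷ xs) _
  x∷xs#ys (here refl , x∈ys) = All.lookup (All.++⁻ʳ xs h) x∈ys refl
  x∷xs#ys (there v∈xs , v∈ys) = xs#ys (v∈xs , v∈ys)

All-stackGo : ∀ {p} {P : Pred ℕ p} st xs → All P st → All P xs → All P (stackGo st xs)
All-stackGo st []       pst []         = pst
All-stackGo st (x ∷ xs) pst (px ∷ pxs) rewrite span-defn (_<? x) st =
  All.++⁺ (All.takeWhile⁺ (_<? x) pst)
          (All-stackGo (x ∷ dropWhile (_<? x) st) xs (px ∷ All.dropWhile⁺ (_<? x) pst) pxs)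

All-S : ∀ {p} {P : Pred ℕ p} {π} → All P π → All P (S π)
All-S = All-stackGo [] _ []

S-⊆ : ∀ π → S π ⊆ π
S-⊆ π = All.lookup (All-S (All.tabulate id))

stackGo-++-max : ∀ {m} st α β → All (_< m) st → All (_< m) α →
                 stackGo st (α ++ m ∷ β) ≡ stackGo st α ++ stackGo [ m ] β
stackGo-++-max {m} st [] β pst []
  rewrite span-defn (_<? m) st
        | All.all⇒takeWhile≗id (_<? m) pst
        | All.all⇒dropWhile≡[] (_<? m) pst = refl
stackGo-++-max st (x ∷ α) β pst (px ∷ pα) rewrite span-defn (_<? x) st =
  trans (cong (takeWhile (_<? x) st ++_)
              (stackGo-++-max (x ∷ dropWhile (_<? x) st) α β
                              (px ∷ All.dropWhile⁺ (_<? x) pst) pα))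
        (sym (++-assoc (takeWhile (_<? x) st) _ _))

stackGo-max-bottom : ∀ {m} st β → All (_< m) st → All (_< m) β →
                     stackGo (st ++ [ m ]) β ≡ stackGo st β ++ [ m ]
stackGo-max-bottom st [] pst [] = refl
stackGo-max-bottom {m} st (x ∷ β) pst (px ∷ pβ)
  rewrite span-defn (_<? x) (st ++ [ m ]) | span-defn (_<? x) st = begin
    takeWhile <x? (st ++ [ m ]) ++ stackGo (x ∷ dropWhile <x? (st ++ [ m ])) β
      ≡⟨ cong₂ (λ t d → t ++ stackGo (x ∷ d) β)
               (takeWhile-++-stop <x? (<⇒≯ px) st []) (dropWhile-++-stop <x? (<⇒≯ px) st []) ⟩
    takeWhile <x? st ++ stackGo ((x ∷ dropWhile <x? st) ++ [ m ]) β
      ≡⟨ cong (takeWhile <x? st ++_)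
              (stackGo-max-bottom (x ∷ dropWhile <x? st) β (px ∷ All.dropWhile⁺ <x? pst) pβ) ⟩
    takeWhile <x? st ++ stackGo (x ∷ dropWhile <x? st) β ++ [ m ]
      ≡⟨ ++-assoc (takeWhile <x? st) _ _ ⟨
    (takeWhile <x? st ++ stackGo (x ∷ dropWhile <x? st) β) ++ [ m ] ∎
  where
  open ≡-Reasoning
  <x? = _<? x

S-++-max : ∀ {m} α β → All (_< m) α → All (_< m) β → S (α ++ m ∷ β) ≡ S α ++ S β ++ [ m ]
S-++-max α β pα pβ =
  trans (stackGo-++-max [] α β [] pα) (cong (S α ++_) (stackGo-max-bottom [] β [] pβ))

All<-max-word : ∀ {m k} α₁ α₂ β → All (_< m) (α₁ ++ α₂) → All (_< m) β → m < k →
                All (_< k) (α₁ ++ α₂ ++ m ∷ β)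
All<-max-word {m} {k} α₁ α₂ β pα pβ m<k =
  subst (All (_< k)) (++-assoc α₁ α₂ (m ∷ β))
    (All.++⁺ (All.map (λ x<m → <-trans x<m m<k) pα)
             (m<k ∷ All.map (λ x<m → <-trans x<m m<k) pβ))

InU-++ : ∀ {p w q v} → InU p w → InU q v → Disjoint p q → InU (p ++ q) (w ++ v)
InU-++ U-nil d₂ _ = d₂
InU-++ {p} {w} (U-cons α₁ α₂ m β γ δ pα pβ h₁ h₂) = absorb
  where
  absorb : ∀ {q v} → InU q v → Disjoint p q → InU (p ++ q) (w ++ v)
  absorb U-nil _ =
    subst₂ InU (sym (++-identityʳ p)) (sym (++-identityʳ w)) (U-cons α₁ α₂ m β γ δ pα pβ h₁ h₂)
  absorb d₂@(U-cons α₁′ α₂′ m′ β′ γ′ δ′ pα′ pβ′ h₁′ h₂′) p#q with <-cmp m m′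
  ... | tri≈ _ m≡m′ _ = ⊥-elim (p#q (max∈ α₁ α₂ β refl , max∈ α₁′ α₂′ β′ (sym m≡m′)))
    where
    max∈ : ∀ {m′} α₁ α₂ β → m′ ≡ m → m ∈ α₁ ++ α₂ ++ m′ ∷ β
    max∈ α₁ α₂ β m′≡m = ∈-++⁺ʳ α₁ (∈-++⁺ʳ α₂ (here (sym m′≡m)))
  ... | tri> _ _ m′<m =
    subst₂ InU
      (trans (cong (α₁ ++_) (sym (++-assoc α₂ (m ∷ β) q))) (sym (++-assoc α₁ _ q)))
      (sym (++-assoc γ (m ∷ δ) _))
      (U-cons α₁ α₂ m (β ++ q) γ (δ ++ _)
        pα (All.++⁺ pβ (All<-max-word α₁′ α₂′ β′ pα′ pβ′ m′<m)) h₁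
        (subst (λ r → InU r _) (++-assoc α₂ β q)
          (InU-++ h₂ d₂ (λ (i , j) → p#q (rest⊆p i , j)))))
    where
    q = α₁′ ++ α₂′ ++ m′ ∷ β′
    rest⊆p : α₂ ++ β ⊆ p
    rest⊆p = xs⊆ys++xs _ α₁ ∘ ++⁺ʳ α₂ (xs⊆x∷xs β m)
  ... | tri< m<m′ _ _ =
    subst₂ InU (++-assoc p α₁′ _) (++-assoc (γ ++ m ∷ δ) γ′ _)
      (U-cons (p ++ α₁′) α₂′ m′ β′ (_ ++ γ′) δ′
        (subst (All (_< m′)) (sym (++-assoc p α₁′ α₂′))
          (All.++⁺ (All<-max-word α₁ α₂ β pα pβ m<m′) pα′))
        pβ′ (absorb h₁′ (λ (i , j) → p#q (i , xs⊆xs++ys α₁′ _ j))) h₂′)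

restrict-++ : ∀ A xs ys → restrict A (xs ++ ys) ≡ restrict A xs ++ restrict A ys
restrict-++ A = filter-++ (T? ∘ A)

All-restrict-S : ∀ {p} {P : Pred ℕ p} A {π} → All P π → All P (restrict A (S π))
All-restrict-S A = All.filter⁺ (T? ∘ A) ∘ All-S

restrict-S-⊆ : ∀ A π → restrict A (S π) ⊆ π
restrict-S-⊆ A π = S-⊆ π ∘ filter-⊆ (T? ∘ A) (S π)

InU-restrict-S-++-max : ∀ {m} A α β → All (_< m) α → All (_< m) β → Disjoint α β →
                        InU (restrict A (S α)) (restrict A α) →
                        InU (restrict A (S β)) (restrict A β) →
                        InU (restrict A (S (α ++ m ∷ β))) (restrict A (α ++ m ∷ β))
InU-restrict-S-++-max {m} A α β pα pβ α#β hα hβ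
  rewrite S-++-max α β pα pβ
        | restrict-++ A (S α) (S β ++ [ m ])
        | restrict-++ A (S β) [ m ]
        | restrict-++ A α (m ∷ β)
  with A m
... | true =
  U-cons (restrict A (S α)) (restrict A (S β)) m [] (restrict A α) (restrict A β)
    (All.++⁺ (All-restrict-S A pα) (All-restrict-S A pβ)) [] hα
    (subst (λ r → InU r (restrict A β)) (sym (++-identityʳ _)) hβ)
... | false =
  subst (λ r → InU (restrict A (S α) ++ r) (restrict A α ++ restrict A β))
    (sym (++-identityʳ _))
    (InU-++ hα hβ (λ (i , j) → α#β (restrict-S-⊆ A α i , restrict-S-⊆ A β j)))

data MaxSplit : List ℕ → Set where
  empty : MaxSplit []
  split : ∀ α m β → All (_≤ m) α → All (_≤ m) β → MaxSplit (α ++ m ∷ β)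

maxSplit : ∀ π → MaxSplit π
maxSplit [] = empty
maxSplit (x ∷ xs) with maxSplit xs
... | empty = split [] x [] [] []
... | split α m β α≤m β≤m with x ≤? m
...   | yes x≤m = split (x ∷ α) m β (x≤m ∷ α≤m) β≤m
...   | no x≰m  = split [] x (α ++ m ∷ β) []
      (All.++⁺ (All.map (λ y≤m → ≤-trans y≤m m≤x) α≤m)
               (m≤x ∷ All.map (λ y≤m → ≤-trans y≤m m≤x) β≤m))
      where m≤x = <⇒≤ (≰⇒> x≰m)

All≤∧∉⇒All< : ∀ {m xs} → All (_≤ m) xs → m ∉ xs → All (_< m) xs
All≤∧∉⇒All< []           _  = []
All≤∧∉⇒All< (x≤m ∷ xs≤m) m∉ with m≤n⇒m<n∨m≡n x≤m
... | inj₁ x<m  = x<m ∷ All≤∧∉⇒All< xs≤m (m∉ ∘ there)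
... | inj₂ refl = ⊥-elim (m∉ (here refl))

length-sides< : ∀ α (m : ℕ) β →
                length α < length (α ++ m ∷ β) × length β < length (α ++ m ∷ β)
length-sides< α m β rewrite length-++ α {m ∷ β} =
  m<m+n (length α) z<s , m≤n+m (suc (length β)) (length α)

InU-restrict-S-bounded : ∀ k π → length π < k → Unique π → (A : ℕ → Bool) →
                         InU (restrict A (S π)) (restrict A π)
InU-restrict-S-bounded (suc k) π |π|<k u A with maxSplit π
... | empty = U-nil
... | split α m β α≤m β≤m with Unique-++⁻ α u
...   | uα , m∉β ∷ uβ , α#mβ =
  InU-restrict-S-++-max A α β
    (All≤∧∉⇒All< α≤m (λ m∈α → α#mβ (m∈α , here refl)))
    (All≤∧∉⇒All< β≤m (λ m∈β → All.lookup m∉β m∈β refl))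
    (λ (i , j) → α#mβ (i , there j))
    (InU-restrict-S-bounded k α (shorter |α|<) uα A)
    (InU-restrict-S-bounded k β (shorter |β|<) uβ A)
  where
  |α|< = proj₁ (length-sides< α m β)
  |β|< = proj₂ (length-sides< α m β)
  shorter : ∀ {n} → n < length (α ++ m ∷ β) → n < k
  shorter n< = <-≤-trans n< (≤-pred |π|<k)

IsPerm⇒Unique : ∀ n π → IsPerm n π → Unique π
IsPerm⇒Unique n π π↭ =
  Unique-resp-↭ (setoid ℕ) (Perm.↭⇒↭ₛ (Perm.↭-sym π↭))
    (Unique.map⁺ suc-injective (Unique.upTo⁺ n))

proposition4p1 : (n : ℕ) (π : List ℕ) → IsPerm n π → (A : ℕ → Bool) →
                   InU (restrict A (S π)) (restrict A π)
proposition4p1 n π π↭ =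
  InU-restrict-S-bounded (suc (length π)) π ≤-refl (IsPerm⇒Unique n π π↭)
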